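{- RCP is sound and complete on straight-line string constraints: a straight-line string constraint is unsatisfiable if and only if it admits a closed proof in the RCP proof system. In particular, every unsatisfiable straight-line string constraint admits a closed proof in the RCP proof system using only the rules Close, Intersect and Bwd-Prop.
   Context: Fix a finite alphabet $\Sigma$; string variables take values in $\Sigma^*$. A string constraint is a finite conjunction (equivalently a finite set, called a sequent) of regular constraints $x\in e$ ($e$ a regular expression with language $L(e)$) and equational constraints $x=f(x_1,\dots,x_n)$ with $f:(\Sigma^*)^n\to\Sigma^*$ a string function; it is satisfiable if some assignment of strings to the variables satisfies every conjunct. $f$ is backwardable if for every regular $L$ the preimage $f^{ -1}(L)$ equals a finite union $\bigcup_{i=1}^k L_{i,1}\times\dots\times L_{i,n}$ of products of regular languages, computable from $L$. A string constraint is straight-line if all functions in its equational constraints are backwardable and its equational constraints can be enumerated $\phi_1,\dots,\phi_n$, $\phi_i=(x_i=f_i(\bar y_i))$, such that for every $i$ the variable $x_i$ has exactly one occurrence (counted with multiplicity, on either side) in $\phi_i,\phi_{i+1},\dots,\phi_n$ (equivalently, the equational part admits a flow sequence $(\phi_1,\rightarrow),\dots,(\phi_n,\rightarrow)$ of backward propagations only). RCP proof system: proof trees of sequents with the root at the bottom; a node has as children the premises of the rule applied to it. Rules: Close: a sequent $\Gamma, x\in e_1,\dots,x\in e_n$ with $L(e_1)\cap\dots\cap L(e_n)=\emptyset$ needs no premise (closed leaf). Intersect: $\Gamma, x\in e_1,\dots,x\in e_n$ has premise $\Gamma, x\in e$ with $L(e)=\bigcap_i L(e_i)$. Fwd-Prop: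 $\Gamma, x_1\in e_1,\dots,x_n\in e_n, x=f(x_1,\dots,x_n)$ has premise $\Gamma, x\in e, x=f(x_1,\dots,x_n), x_1\in e_1,\dots,x_n\in e_n$ with $L(e)=f(L(e_1),\dots,L(e_n))$. Bwd-Prop: $\Gamma, x\in e, x=f(x_1,\dots,x_n)$ has the premises $\Gamma, x\in e, x=f(x_1,\dots,x_n), x_1\in e^i_1,\dots,x_n\in e^i_n$, $i=1,\dots,k$, where $f^{ -1}(L(e))=\bigcup_{i=1}^k L(e^i_1)\times\dots\times L(e^i_n)$. A proof is closed if every leaf is closed by Close. A variable with no regular constraint is regarded as constrained by $\Sigma^*$. -}

module Defs where

open import Data.Nat using (ℕ; zero; suc; _+_; _≡ᵇ_)
open import Data.Fin using (Fin)
open import Data.Bool using (Bool; true; false; if_then_else_; T)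
open import Data.List using (List; []; _∷_; [_]; _++_; tabulate; map)
open import Data.Nat.ListAction using (sum)
open import Data.List.Membership.Propositional using (_∈_)
open import Data.List.Relation.Unary.All using (All)
open import Data.List.Relation.Unary.Any using (Any)
open import Data.List.Relation.Unary.Unique.Propositional using (Unique)
open import Data.List.Relation.Binary.BagAndSetEquality using (_∼[_]_; set)
open import Data.Product using (Σ; ∃; _×_; _,_)
open import Data.Sum using (_⊎_)
open import Data.Unit using (⊤)
open import Relation.Nullary using (¬_)
open import Relation.Binary.PropositionalEquality using (_≡_)
open import Function.Bundles using (_⇔_)

Word : ℕ → Set
Word k = List (Fin k)

data RegExp (k : ℕ) : Set where
  ∅ε   : RegExp k                         -- empty language
  eps  : RegExp k
  chr  : Fin k → RegExp k
  _⊕_  : RegExp k → RegExp k → RegExp k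
  _⊙_  : RegExp k → RegExp k → RegExp k
  _⋆   : RegExp k → RegExp k

data _∈L_ {k : ℕ} : Word k → RegExp k → Set where
  in-eps : [] ∈L eps
  in-chr : ∀ {a} → [ a ] ∈L chr a
  in-⊕ˡ  : ∀ {w e f} → w ∈L e → w ∈L (e ⊕ f)
  in-⊕ʳ  : ∀ {w e f} → w ∈L f → w ∈L (e ⊕ f)
  in-⊙   : ∀ {u v e f} → u ∈L e → v ∈L f → (u ++ v) ∈L (e ⊙ f)
  in-⋆0  : ∀ {e} → [] ∈L (e ⋆)
  in-⋆s  : ∀ {u v e} → u ∈L e → v ∈L (e ⋆) → (u ++ v) ∈L (e ⋆)

Full : ∀ {k} → RegExp k → Set
Full e = ∀ w → w ∈L e

Var : Set
Var = ℕ

record Eqn (k : ℕ) : Set where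
  constructor mkEqn
  field
    lhs   : Var
    arity : ℕ
    fun   : (Fin arity → Word k) → Word k
    args  : Fin arity → Var
open Eqn public

data Constraint (k : ℕ) : Set where
  reg : Var → RegExp k → Constraint k
  eqn : Eqn k → Constraint k

-- Sequents are finite sets of constraints, represented by lists
-- (considered up to set equality _∼[ set ]_ where relevant).
Sequent : ℕ → Set
Sequent k = List (Constraint k)

Assignment : ℕ → Set
Assignment k = Var → Word k

Holds : ∀ {k} → Assignment k → Constraint k → Set
Holds ν (reg x e) = ν x ∈L e
Holds ν (eqn E)   = ν (lhs E) ≡ fun E (λ i → ν (args E i))

Satisfiable : ∀ {k} → Sequent k → Set
Satisfiable {k} S = Σ (Assignment k) λ ν → All (Holds ν) S

Unsatisfiable : ∀ {k} → Sequent k → Set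
Unsatisfiable S = ¬ Satisfiable S

Backwardable : ∀ {k} (n : ℕ) → ((Fin n → Word k) → Word k) → Set
Backwardable {k} n f =
  (e : RegExp k) →
  Σ (List (Fin n → RegExp k)) λ ds →
    ∀ (ws : Fin n → Word k) →
      (f ws ∈L e) ⇔ Any (λ d → ∀ i → ws i ∈L d i) ds

occ : ∀ {k} → Var → Eqn k → ℕ
occ y E = (if lhs E ≡ᵇ y then 1 else 0)
        + sum (tabulate (λ i → if args E i ≡ᵇ y then 1 else 0))

occs : ∀ {k} → Var → List (Eqn k) → ℕ
occs y []       = 0
occs y (E ∷ Es) = occ y E + occs y Es

StraightLineOrder : ∀ {k} → List (Eqn k) → Set
StraightLineOrder []       = ⊤
StraightLineOrder (E ∷ Es) = (occs (lhs E) (E ∷ Es) ≡ 1) × StraightLineOrder Es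

StraightLine : ∀ {k} → Sequent k → Set
StraightLine {k} S =
  (∀ E → eqn E ∈ S → Backwardable (arity E) (fun E)) ×
  Σ (List (Eqn k)) λ φs →
    Unique φs × (∀ E → (eqn E ∈ S) ⇔ (E ∈ φs)) × StraightLineOrder φs

-- x ∈ e is in S, or x is regarded as constrained by Σ* (L(e) = Σ*)
RegIn : ∀ {k} → Sequent k → Var → RegExp k → Set
RegIn S x e = reg x e ∈ S ⊎ Full e

-- The Bool flag says whether Fwd-Prop may be used
-- (true: full RCP; false: only Close, Intersect, Bwd-Prop).
-- Being inductive with Close as the only premise-free rule (besides
-- Bwd-Prop with k = 0 premises), every inhabitant is a finite closed proof.
data RCP {k : ℕ} (fwd : Bool) : Sequent k → Set where
  close : ∀ {S} (x : Var) (es : List (RegExp k)) →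
          All (λ e → reg x e ∈ S) es →
          (∀ w → ¬ All (λ e → w ∈L e) es) →
          RCP fwd S
  intersect : ∀ {S} (Γ : Sequent k) (x : Var) (es : List (RegExp k)) (e : RegExp k) →
          S ∼[ set ] (Γ ++ map (reg x) es) →
          (∀ w → (w ∈L e) ⇔ All (λ e′ → w ∈L e′) es) →
          RCP fwd (reg x e ∷ Γ) →
          RCP fwd S
  fwd-prop : ∀ {S} → T fwd → (E : Eqn k) → eqn E ∈ S →
          (es : Fin (arity E) → RegExp k) →
          (∀ i → RegIn S (args E i) (es i)) →
          (e : RegExp k) →
          (∀ w → (w ∈L e) ⇔
             (Σ (Fin (arity E) → Word k) λ ws → (∀ i → ws i ∈L es i) × fun E ws ≡ w)) →
          RCP fwd (reg (lhs E) e ∷ (tabulate (λ i → reg (args E i) (es i)) ++ S)) →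
          RCP fwd S
  bwd-prop : ∀ {S} (E : Eqn k) → eqn E ∈ S →
          (e : RegExp k) → RegIn S (lhs E) e →
          (ds : List (Fin (arity E) → RegExp k)) →
          (∀ ws → (fun E ws ∈L e) ⇔ Any (λ d → ∀ i → ws i ∈L d i) ds) →
          (∀ d → d ∈ ds →
             RCP fwd (reg (lhs E) e ∷ (tabulate (λ i → reg (args E i) (d i)) ++ S))) →
          RCP fwd S

{-# OPTIONS --safe #-}
-- Soundness: an assignment satisfying the conclusion of a rule satisfies one of its premises.
--
-- Completeness follows the straight-line order φ₁, …, φₙ. The left-hand side x of φ₁ occurs
-- neither among its arguments nor in a later equation, so once Bwd-Prop has pulled every
-- regular constraint on x back to the arguments of φ₁, each solution of the remaining
-- constraints and equations extends to the whole sequent by setting x := f(arguments).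
-- When no equation is left, an unsatisfiable sequent has a variable whose regular constraints
-- have empty intersection, and Close refutes it. Finding that variable constructively needs
-- emptiness of intersections of regular languages to be decidable: Antimirov's partial
-- derivatives turn an expression into an automaton with finitely many reachable states,
-- products of such automata stay finite, and reachability of an accepting state is decided by
-- iterating a monotone predicate on the finite state set until it stabilises.

module Submission where

open import Defs
open import Data.Bool using (Bool; true; false; T; _∧_; _∨_; if_then_else_)
open import Data.Bool.Properties using (T-∧; T-∨; T-≡)
open import Data.Empty using (⊥; ⊥-elim)
open import Data.Fin as Fin using (Fin) renaming (_≟_ to _≟ᶠ_)
open import Data.Bool.ListAction using (any)
open import Data.List
  using (List; []; _∷_; [_]; _++_; map; tabulate; allFin; filter; length; cartesianProduct)
open import Data.List.Membership.Propositional using (_∈_; find; lose)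
open import Data.List.Membership.Propositional.Properties
  using (∈-allFin; ∈-cartesianProduct⁺; ∈-cartesianProduct⁻; ∈-map⁺; ∈-map⁻; ∈-tabulate⁺)
open import Data.List.Relation.Binary.Subset.Propositional using (_⊆_)
open import Data.List.Relation.Binary.Subset.Propositional.Properties as ⊆
  using (xs⊆xs++ys; xs⊆ys++xs)
open import Data.List.Relation.Unary.All as All using (All; []; _∷_)
import Data.List.Relation.Unary.All.Properties as Allₚ
open import Data.List.Relation.Unary.Any as Any using (Any; here; there)
open import Data.List.Relation.Unary.Any.Properties
  using (any⁺; any⁻; ++⁺ˡ; ++⁺ʳ; ++⁻; map⁺; map⁻; cartesianProductWith⁺; cartesianProductWith⁻)
open import Data.Nat using (ℕ; zero; suc; _≤_; _<_; z≤n; s≤s; _≡ᵇ_; _≟_)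
open import Data.Nat.ListAction using (sum)
open import Data.Nat.Properties
  using (≤-trans; m≤n⇒m≤1+n; n≮n; ≡⇒≡ᵇ; m+n≡0⇒m≡0; m+n≡0⇒n≡0; suc-injective)
open import Data.List.Properties using (length-filter)
open import Data.Product using (∃; _×_; _,_)
open import Data.Sum using (_⊎_; inj₁; inj₂; [_,_]′)
open import Data.Unit using (⊤; tt)
open import Function using (_∘_; id)
open import Function.Bundles using (_⇔_; mk⇔; Equivalence)
open import Relation.Binary.PropositionalEquality using (_≡_; _≢_; refl; sym; trans; cong; subst)
open import Relation.Nullary using (Dec; yes; no; ¬_; contradiction)
open import Relation.Nullary.Decidable using (map′; T?; ¬?; decidable-stable)
open import Relation.Unary using (Decidable)

-- Finite automata and decidable emptiness

module _ {A : Set} {P Q : A → Set} (P? : Decidable P) (Q? : Decidable Q) where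

  length-filter-mono : ∀ xs → (∀ {x} → x ∈ xs → P x → Q x) →
                       length (filter P? xs) ≤ length (filter Q? xs)
  length-filter-mono []       _   = z≤n
  length-filter-mono (x ∷ xs) P⇒Q with P? x | Q? x
  ... | yes p | no ¬q = ⊥-elim (¬q (P⇒Q (here refl) p))
  ... | yes _ | yes _ = s≤s (length-filter-mono xs (P⇒Q ∘ there))
  ... | no _  | yes _ = m≤n⇒m≤1+n (length-filter-mono xs (P⇒Q ∘ there))
  ... | no _  | no _  = length-filter-mono xs (P⇒Q ∘ there)

  length-filter-grows : ∀ xs → (∀ {x} → x ∈ xs → P x → Q x) →
                        (∀ {x} → x ∈ xs → Q x → P x) ⊎ length (filter P? xs) < length (filter Q? xs)
  length-filter-grows []       _   = inj₁ λ ()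
  length-filter-grows (x ∷ xs) P⇒Q with P? x | Q? x | length-filter-grows xs (P⇒Q ∘ there)
  ... | yes p | no ¬q | _        = ⊥-elim (¬q (P⇒Q (here refl) p))
  ... | no _  | yes _ | _        = inj₂ (s≤s (length-filter-mono xs (P⇒Q ∘ there)))
  ... | yes _ | yes _ | inj₂ lt  = inj₂ (s≤s lt)
  ... | no _  | no _  | inj₂ lt  = inj₂ lt
  ... | yes p | yes _ | inj₁ Q⇒P = inj₁ λ { (here refl) _ → p ; (there x∈) → Q⇒P x∈ }
  ... | no _  | no ¬q | inj₁ Q⇒P = inj₁ λ { (here refl) q → ⊥-elim (¬q q) ; (there x∈) → Q⇒P x∈ }

module _ {A : Set} {P : ℕ → A → Set} (P? : ∀ n → Decidable (P n))
         (P-suc : ∀ {n x} → P n x → P (suc n) x) (xs : List A) where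

  private
    StableAt : ℕ → Set
    StableAt n = ∀ {x} → x ∈ xs → P (suc n) x → P n x

    size : ℕ → ℕ
    size n = length (filter (P? n) xs)

    stable-or-large : ∀ n → ∃ StableAt ⊎ n ≤ size n
    stable-or-large zero = inj₂ z≤n
    stable-or-large (suc n) with stable-or-large n
    ... | inj₁ stable = inj₁ stable
    ... | inj₂ n≤size with length-filter-grows (P? n) (P? (suc n)) xs (λ _ → P-suc)
    ...   | inj₁ stable = inj₁ (n , stable)
    ...   | inj₂ size< = inj₂ (≤-trans (s≤s n≤size) size<)

  stabilises : ∃ λ n → ∀ {x} → x ∈ xs → P (suc n) x → P n x
  stabilises with stable-or-large (suc (length xs))
  ... | inj₁ stable = stable
  ... | inj₂ large = ⊥-elim (n≮n _ (≤-trans large (length-filter (P? _) xs)))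

record NFA (k : ℕ) : Set₁ where
  field
    State     : Set
    accepting : State → Bool
    step      : Fin k → State → List State

open NFA

module _ {k : ℕ} (A : NFA k) where

  Accepts : State A → Word k → Set
  Accepts q []      = T (accepting A q)
  Accepts q (a ∷ w) = Any (λ q′ → Accepts q′ w) (step A a q)

  Closed : List (State A) → Set
  Closed U = ∀ a {q} → q ∈ U → step A a q ⊆ U

  acceptsWithin : ℕ → State A → Bool
  acceptsWithin zero    q = accepting A q
  acceptsWithin (suc n) q =
    acceptsWithin n q ∨ any (λ a → any (acceptsWithin n) (step A a q)) (allFin k)

  acceptsWithin-suc : ∀ n {q} → T (acceptsWithin n q) → T (acceptsWithin (suc n) q)
  acceptsWithin-suc _ h = Equivalence.from T-∨ (inj₁ h)

  acceptsWithin-accepting : ∀ n {q} → T (accepting A q) → T (acceptsWithin n q)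
  acceptsWithin-accepting zero    = id
  acceptsWithin-accepting (suc n) = acceptsWithin-suc n ∘ acceptsWithin-accepting n

  acceptsWithin-sound : ∀ n q → T (acceptsWithin n q) → ∃ (Accepts q)
  acceptsWithin-sound zero    q h = [] , h
  acceptsWithin-sound (suc n) q h with Equivalence.to T-∨ h
  ... | inj₁ h′ = acceptsWithin-sound n q h′
  ... | inj₂ h′ =
    let a , h″ = Any.satisfied (any⁻ _ (allFin k) h′)
        q′ , q′∈ , h‴ = find (any⁻ (acceptsWithin n) (step A a q) h″)
        w , acc = acceptsWithin-sound n q′ h‴
    in a ∷ w , lose q′∈ acc

  Stable : List (State A) → ℕ → Set
  Stable U n = ∀ {q} → q ∈ U → T (acceptsWithin (suc n) q) → T (acceptsWithin n q)

  acceptsWithin-complete : ∀ {U} n → Closed U → Stable U n →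
    ∀ {q} → q ∈ U → ∀ w → Accepts q w → T (acceptsWithin n q)
  acceptsWithin-complete n closed stable q∈ []      acc = acceptsWithin-accepting n acc
  acceptsWithin-complete n closed stable q∈ (a ∷ w) acc =
    let q′ , q′∈ , acc′ = find acc
        h = acceptsWithin-complete n closed stable (closed a q∈ q′∈) w acc′
    in stable q∈ (Equivalence.from T-∨ (inj₂ (any⁺ _ (lose (∈-allFin a) (any⁺ _ (lose q′∈ h))))))

  accepts? : ∀ {U} → Closed U → ∀ {q} → q ∈ U → Dec (∃ (Accepts q))
  accepts? {U} closed {q} q∈ =
    let n , stable = stabilises (λ n q → T? (acceptsWithin n q)) (λ {n} → acceptsWithin-suc n) U
    in map′ (acceptsWithin-sound n q)
            (λ (w , acc) → acceptsWithin-complete n closed stable q∈ w acc)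
            (T? (acceptsWithin n q))

module _ {k : ℕ} where

  _⊗_ : NFA k → NFA k → NFA k
  A ⊗ B = record
    { State     = State A × State B
    ; accepting = λ (p , q) → accepting A p ∧ accepting B q
    ; step      = λ a (p , q) → cartesianProduct (step A a p) (step B a q)
    }

  accepts-⊗ : ∀ A B {p q} w → Accepts (A ⊗ B) (p , q) w ⇔ (Accepts A p w × Accepts B q w)
  accepts-⊗ A B []      = T-∧
  accepts-⊗ A B (a ∷ w) = mk⇔
    (cartesianProductWith⁻ _,_ (Equivalence.to (accepts-⊗ A B w)) _ _)
    (λ (p′ , q′) →
      cartesianProductWith⁺ _,_ (λ p q → Equivalence.from (accepts-⊗ A B w) (p , q)) p′ q′)

  ⊗-closed : ∀ {A B U V} → Closed A U → Closed B V → Closed (A ⊗ B) (cartesianProduct U V)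
  ⊗-closed {U = U} {V} closedU closedV a pq∈ r∈ =
    let p∈ , q∈ = ∈-cartesianProduct⁻ U V pq∈
        p′∈ , q′∈ = ∈-cartesianProduct⁻ _ _ r∈
    in ∈-cartesianProduct⁺ (closedU a p∈ p′∈) (closedV a q∈ q′∈)

  universal : NFA k
  universal = record { State = ⊤ ; accepting = λ _ → true ; step = λ _ _ → [ tt ] }

  accepts-universal : ∀ w → Accepts universal tt w
  accepts-universal []      = tt
  accepts-universal (_ ∷ w) = here (accepts-universal w)

  universal-closed : Closed universal [ tt ]
  universal-closed _ (here refl) (here refl) = here refl

-- Antimirov's partial derivatives

module _ {A : Set} where

  ⊆-if : ∀ b {xs ys : List A} → xs ⊆ ys → (if b then xs else []) ⊆ ys
  ⊆-if true xs⊆ys = xs⊆ys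

  Any-if⁺ : ∀ {P : A → Set} {b xs} → T b → Any P xs → Any P (if b then xs else [])
  Any-if⁺ {b = true} _ p = p

  Any-if⁻ : ∀ {P : A → Set} b {xs} → Any P (if b then xs else []) → T b × Any P xs
  Any-if⁻ true p = tt , p

module _ {k : ℕ} where

  nullable : RegExp k → Bool
  nullable ∅ε      = false
  nullable eps     = true
  nullable (chr _) = false
  nullable (e ⊕ f) = nullable e ∨ nullable f
  nullable (e ⊙ f) = nullable e ∧ nullable f
  nullable (e ⋆)   = true

  nullable-sound : ∀ e → T (nullable e) → [] ∈L e
  nullable-sound eps     _ = in-eps
  nullable-sound (e ⊕ f) h =
    [ in-⊕ˡ ∘ nullable-sound e , in-⊕ʳ ∘ nullable-sound f ]′ (Equivalence.to T-∨ h)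
  nullable-sound (e ⊙ f) h =
    let he , hf = Equivalence.to T-∧ h in in-⊙ (nullable-sound e he) (nullable-sound f hf)
  nullable-sound (e ⋆)   _ = in-⋆0

  nullable-complete : ∀ {w e} → w ∈L e → w ≡ [] → T (nullable e)
  nullable-complete in-eps              _  = tt
  nullable-complete (in-⊕ˡ p)           eq = Equivalence.from T-∨ (inj₁ (nullable-complete p eq))
  nullable-complete (in-⊕ʳ p)           eq = Equivalence.from T-∨ (inj₂ (nullable-complete p eq))
  nullable-complete (in-⊙ {u = []} p q) eq =
    Equivalence.from T-∧ (nullable-complete p refl , nullable-complete q eq)
  nullable-complete in-⋆0               _  = tt
  nullable-complete (in-⋆s _ _)         _  = tt

  ∂ : Fin k → RegExp k → List (RegExp k)
  ∂ a ∅ε      = []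
  ∂ a eps     = []
  ∂ a (chr b) with a ≟ᶠ b
  ... | yes _ = [ eps ]
  ... | no _  = []
  ∂ a (e ⊕ f) = ∂ a e ++ ∂ a f
  ∂ a (e ⊙ f) = map (_⊙ f) (∂ a e) ++ (if nullable e then ∂ a f else [])
  ∂ a (e ⋆)   = map (_⊙ (e ⋆)) (∂ a e)

  ∂-complete : ∀ {a w u e} → u ∈L e → u ≡ a ∷ w → Any (w ∈L_) (∂ a e)
  ∂-complete {a} (in-chr {b}) refl with a ≟ᶠ b
  ... | yes _ = here in-eps
  ... | no a≢b = contradiction refl a≢b
  ∂-complete (in-⊕ˡ p) eq = ++⁺ˡ (∂-complete p eq)
  ∂-complete {a} (in-⊕ʳ {e = e} p) eq = ++⁺ʳ (∂ a e) (∂-complete p eq)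
  ∂-complete {a} (in-⊙ {u = []} {e = e} p q) eq =
    ++⁺ʳ (map _ (∂ a e)) (Any-if⁺ (nullable-complete p refl) (∂-complete q eq))
  ∂-complete (in-⊙ {u = _ ∷ _} p q) refl =
    ++⁺ˡ (map⁺ (Any.map (λ r → in-⊙ r q) (∂-complete p refl)))
  ∂-complete (in-⋆s {u = []} _ q) eq = ∂-complete q eq
  ∂-complete (in-⋆s {u = _ ∷ _} p q) refl = map⁺ (Any.map (λ r → in-⊙ r q) (∂-complete p refl))

  ∂-sound : ∀ {a} e {w} → Any (w ∈L_) (∂ a e) → (a ∷ w) ∈L e
  ∂-sound {a} (chr b) p with a ≟ᶠ b
  ∂-sound (chr b) (here in-eps) | yes refl = in-chr
  ∂-sound {a} (e ⊕ f) p = [ in-⊕ˡ ∘ ∂-sound e , in-⊕ʳ ∘ ∂-sound f ]′ (++⁻ (∂ a e) p)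
  ∂-sound {a} (e ⊙ f) p with ++⁻ (map (_⊙ f) (∂ a e)) p
  ... | inj₁ q with g , g∈ , in-⊙ r s ← find (map⁻ q) = in-⊙ (∂-sound e (lose g∈ r)) s
  ... | inj₂ q with nullable-e , r ← Any-if⁻ (nullable e) q =
    in-⊙ (nullable-sound e nullable-e) (∂-sound f r)
  ∂-sound (e ⋆) p with g , g∈ , in-⊙ r s ← find (map⁻ p) = in-⋆s (∂-sound e (lose g∈ r)) s

  -- Antimirov's finite bound: e ∷ pd⁺ e contains every iterated partial derivative of e.
  pd⁺ : RegExp k → List (RegExp k)
  pd⁺ ∅ε      = []
  pd⁺ eps     = []
  pd⁺ (chr _) = [ eps ]
  pd⁺ (e ⊕ f) = pd⁺ e ++ pd⁺ f
  pd⁺ (e ⊙ f) = map (_⊙ f) (pd⁺ e) ++ pd⁺ f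
  pd⁺ (e ⋆)   = map (_⊙ (e ⋆)) (pd⁺ e)

  ∂⊆pd⁺ : ∀ {a} e → ∂ a e ⊆ pd⁺ e
  ∂⊆pd⁺ ∅ε = λ ()
  ∂⊆pd⁺ eps = λ ()
  ∂⊆pd⁺ {a} (chr b) with a ≟ᶠ b
  ... | yes _ = id
  ... | no _  = λ ()
  ∂⊆pd⁺ (e ⊕ f) = ⊆.++⁺ (∂⊆pd⁺ e) (∂⊆pd⁺ f)
  ∂⊆pd⁺ (e ⊙ f) = ⊆.++⁺ (⊆.map⁺ _ (∂⊆pd⁺ e)) (⊆-if (nullable e) (∂⊆pd⁺ f))
  ∂⊆pd⁺ (e ⋆)   = ⊆.map⁺ _ (∂⊆pd⁺ e)

  ∂-pd⁺⊆pd⁺ : ∀ {a} e {g} → g ∈ pd⁺ e → ∂ a g ⊆ pd⁺ e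
  ∂-pd⁺⊆pd⁺ (chr _) (here refl) = λ ()
  ∂-pd⁺⊆pd⁺ (e ⊕ f) g∈ with ++⁻ (pd⁺ e) g∈
  ... | inj₁ g∈e = xs⊆xs++ys _ _ ∘ ∂-pd⁺⊆pd⁺ e g∈e
  ... | inj₂ g∈f = xs⊆ys++xs _ _ ∘ ∂-pd⁺⊆pd⁺ f g∈f
  ∂-pd⁺⊆pd⁺ (e ⊙ f) g∈ with ++⁻ (map (_⊙ f) (pd⁺ e)) g∈
  ... | inj₂ g∈f = xs⊆ys++xs _ _ ∘ ∂-pd⁺⊆pd⁺ f g∈f
  ... | inj₁ g∈ef with g , g∈e , refl ← ∈-map⁻ (_⊙ f) g∈ef =
    ⊆.++⁺ (⊆.map⁺ _ (∂-pd⁺⊆pd⁺ e g∈e)) (⊆-if (nullable g) (∂⊆pd⁺ f))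
  ∂-pd⁺⊆pd⁺ {a} (e ⋆) g∈ with g , g∈e , refl ← ∈-map⁻ (_⊙ (e ⋆)) g∈ =
    [ ⊆.map⁺ _ (∂-pd⁺⊆pd⁺ e g∈e) , ⊆-if (nullable g) (⊆.map⁺ _ (∂⊆pd⁺ e)) ]′ ∘ ++⁻ (map _ (∂ a g))

  antimirov : NFA k
  antimirov = record { State = RegExp k ; accepting = nullable ; step = ∂ }

  accepts-antimirov : ∀ e w → Accepts antimirov e w ⇔ w ∈L e
  accepts-antimirov e []      = mk⇔ (nullable-sound e) (λ p → nullable-complete p refl)
  accepts-antimirov e (a ∷ w) = mk⇔
    (∂-sound e ∘ Any.map (Equivalence.to (accepts-antimirov _ w)))
    (Any.map (Equivalence.from (accepts-antimirov _ w)) ∘ λ p → ∂-complete p refl)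

  antimirov-closed : ∀ e → Closed antimirov (e ∷ pd⁺ e)
  antimirov-closed e a (here refl) = there ∘ ∂⊆pd⁺ e
  antimirov-closed e a (there h∈)  = there ∘ ∂-pd⁺⊆pd⁺ e h∈

  -- The expressions themselves enter only through the start state ⋂-start es.
  ⋂ : List (RegExp k) → NFA k
  ⋂ []       = universal
  ⋂ (_ ∷ es) = antimirov ⊗ ⋂ es

  ⋂-start : ∀ es → State (⋂ es)
  ⋂-start []       = tt
  ⋂-start (e ∷ es) = e , ⋂-start es

  ⋂-states : ∀ es → List (State (⋂ es))
  ⋂-states []       = [ tt ]
  ⋂-states (e ∷ es) = cartesianProduct (e ∷ pd⁺ e) (⋂-states es)

  ⋂-start∈states : ∀ es → ⋂-start es ∈ ⋂-states es
  ⋂-start∈states []       = here refl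
  ⋂-start∈states (e ∷ es) = ∈-cartesianProduct⁺ {xs = e ∷ pd⁺ e} (here refl) (⋂-start∈states es)

  ⋂-closed : ∀ es → Closed (⋂ es) (⋂-states es)
  ⋂-closed []       = universal-closed
  ⋂-closed (e ∷ es) = ⊗-closed {A = antimirov} {⋂ es} {e ∷ pd⁺ e} (antimirov-closed e) (⋂-closed es)

  accepts-⋂ : ∀ es w → Accepts (⋂ es) (⋂-start es) w ⇔ All (w ∈L_) es
  accepts-⋂ []       w = mk⇔ (λ _ → []) (λ _ → accepts-universal w)
  accepts-⋂ (e ∷ es) w =
    let open Equivalence in
    mk⇔ (λ acc → let p , q = to (accepts-⊗ antimirov (⋂ es) w) acc
                 in to (accepts-antimirov e w) p ∷ to (accepts-⋂ es w) q)
        (λ { (p ∷ q) → from (accepts-⊗ antimirov (⋂ es) w)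
                          (from (accepts-antimirov e w) p , from (accepts-⋂ es w) q) })

  intersection-inhabited? : ∀ es → Dec (∃ λ w → All (w ∈L_) es)
  intersection-inhabited? es =
    map′ (λ (w , acc) → w , Equivalence.to (accepts-⋂ es w) acc)
         (λ (w , ws) → w , Equivalence.from (accepts-⋂ es w) ws)
         (accepts? (⋂ es) (⋂-closed es) (⋂-start∈states es))

-- Soundness

module _ {k : ℕ} where

  RegIn-holds : ∀ {S : Sequent k} {ν x e} → All (Holds ν) S → RegIn S x e → ν x ∈L e
  RegIn-holds hs (inj₁ x∈e∈S) = All.lookup hs x∈e∈S
  RegIn-holds _  (inj₂ full)  = full _

  sound : ∀ {fwd} {S : Sequent k} → RCP fwd S → Unsatisfiable S
  sound (close x es es⊆S empty) (ν , hs) = empty (ν x) (All.map (All.lookup hs) es⊆S)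
  sound (intersect Γ x es e S≈ e≡⋂es premise) (ν , hs) =
    let holds-in-S = λ {c} → All.lookup hs ∘ Equivalence.from (S≈ {c})
        x∈es = All.tabulate λ e′∈es → holds-in-S (xs⊆ys++xs _ Γ (∈-map⁺ (reg x) e′∈es))
        Γ-holds = All.tabulate λ c∈Γ → holds-in-S (xs⊆xs++ys Γ _ c∈Γ)
    in sound premise (ν , Equivalence.from (e≡⋂es (ν x)) x∈es ∷ Γ-holds)
  sound (fwd-prop _ E E∈S es es-hold e image premise) (ν , hs) =
    let args∈es = λ i → RegIn-holds hs (es-hold i)
        lhs∈e = Equivalence.from (image (ν (lhs E)))
                                 (ν ∘ args E , args∈es , sym (All.lookup hs E∈S))
    in sound premise (ν , lhs∈e ∷ Allₚ.++⁺ (Allₚ.tabulate⁺ args∈es) hs)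
  sound (bwd-prop E E∈S e e-holds ds preimage premises) (ν , hs) =
    let lhs∈e = RegIn-holds hs e-holds
        d , d∈ds , args∈d = find (Equivalence.to (preimage (ν ∘ args E))
                                   (subst (_∈L e) (All.lookup hs E∈S) lhs∈e))
    in sound (premises d d∈ds) (ν , lhs∈e ∷ Allₚ.++⁺ (Allₚ.tabulate⁺ args∈d) hs)

-- Completeness on straight-line sequents

module _ {k : ℕ} where

  literal : Word k → RegExp k
  literal []      = eps
  literal (a ∷ w) = chr a ⊙ literal w

  ∈-literal : ∀ w → w ∈L literal w
  ∈-literal []      = in-eps
  ∈-literal (a ∷ w) = in-⊙ in-chr (∈-literal w)

  literal-unique : ∀ w {u} → u ∈L literal w → u ≡ w
  literal-unique []      in-eps          = refl
  literal-unique (a ∷ w) (in-⊙ in-chr p) = cong (a ∷_) (literal-unique w p)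

  -- Without function extensionality an arbitrary f need not respect pointwise equality
  -- of its argument tuple; backwardability recovers it from the preimage of {f ws}.
  backwardable-ext : ∀ {n f} → Backwardable {k} n f →
                     ∀ {ws ws′} → (∀ i → ws i ≡ ws′ i) → f ws ≡ f ws′
  backwardable-ext {f = f} bw {ws} {ws′} ws≗ws′ =
    let ds , preimage = bw (literal (f ws))
        d-ws  = Equivalence.to (preimage ws) (∈-literal (f ws))
        d-ws′ = Any.map (λ {d} ws∈d i → subst (_∈L d i) (ws≗ws′ i) (ws∈d i)) d-ws
    in sym (literal-unique (f ws) (Equivalence.from (preimage ws′) d-ws′))

  BackwardableEqn : Eqn k → Set
  BackwardableEqn E = Backwardable (arity E) (fun E)

  RegSat : Assignment k → Sequent k → Set
  RegSat ν S = ∀ {x e} → reg x e ∈ S → ν x ∈L e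

  EqSat : Assignment k → List (Eqn k) → Set
  EqSat ν = All (Holds ν ∘ eqn)

  regsOf : Var → Sequent k → List (RegExp k)
  regsOf x []            = []
  regsOf x (eqn _ ∷ S)   = regsOf x S
  regsOf x (reg y e ∷ S) with x ≟ y
  ... | yes _ = e ∷ regsOf x S
  ... | no _  = regsOf x S

  regsOf-sound : ∀ {x} S → All (λ e → reg x e ∈ S) (regsOf x S)
  regsOf-sound []            = []
  regsOf-sound (eqn _ ∷ S)   = All.map there (regsOf-sound S)
  regsOf-sound {x} (reg y e ∷ S) with x ≟ y
  ... | yes refl = here refl ∷ All.map there (regsOf-sound S)
  ... | no _     = All.map there (regsOf-sound S)

  regsOf-complete : ∀ {x e} S → reg x e ∈ S → e ∈ regsOf x S
  regsOf-complete (eqn _ ∷ S) (there m) = regsOf-complete S m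
  regsOf-complete {x} (reg y e ∷ S) m with x ≟ y | m
  ... | yes _  | here refl = here refl
  ... | yes _  | there m′  = there (regsOf-complete S m′)
  ... | no x≢y | here refl = contradiction refl x≢y
  ... | no _   | there m′  = regsOf-complete S m′

  Refutes : Sequent k → Constraint k → Set
  Refutes S (reg x _) = ¬ ∃ λ w → All (w ∈L_) (regsOf x S)
  Refutes S (eqn _)   = ⊥

  refutes? : ∀ S → Decidable (Refutes S)
  refutes? S (reg x _) = ¬? (intersection-inhabited? (regsOf x S))
  refutes? S (eqn _)   = no id

  witness : ∀ {P : Word k → Set} → Dec (∃ P) → Word k
  witness (yes (w , _)) = w
  witness (no _)        = []

  witness-sound : ∀ {P : Word k → Set} (P? : Dec (∃ P)) → ∃ P → P (witness P?)
  witness-sound (yes (_ , p)) _ = p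
  witness-sound (no ¬p)       p = contradiction p ¬p

  refute-regular : ∀ {fwd} S → (∀ ν → ¬ RegSat ν S) → RCP fwd S
  refute-regular S unsat with Any.any? (refutes? S) S
  ... | yes refuted with find refuted
  ...   | reg x _ , _ , empty = close x (regsOf x S) (regsOf-sound S) (λ w ws → empty (w , ws))
  refute-regular S unsat | no none = ⊥-elim (unsat ν₀ ν₀-sat)
    where
    ν₀ : Assignment k
    ν₀ x = witness (intersection-inhabited? (regsOf x S))

    ν₀-sat : RegSat ν₀ S
    ν₀-sat {x} x∈e∈S =
      let inhabited? = intersection-inhabited? (regsOf x S)
          inhabited  = decidable-stable inhabited? (none ∘ lose x∈e∈S)
      in All.lookup (witness-sound inhabited? inhabited) (regsOf-complete S x∈e∈S)

  _∉ₑ_ : Var → Eqn k → Set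
  x ∉ₑ E = lhs E ≢ x × (∀ i → args E i ≢ x)

  indicator≡0⇒≢ : ∀ {y x} → (if y ≡ᵇ x then 1 else 0) ≡ 0 → y ≢ x
  indicator≡0⇒≢ {y} eq refl
    with () ← subst (λ b → (if b then 1 else 0) ≡ 0) (Equivalence.to T-≡ (≡⇒≡ᵇ y y refl)) eq

  sum-tabulate≡0 : ∀ {n} (g : Fin n → ℕ) → sum (tabulate g) ≡ 0 → ∀ i → g i ≡ 0
  sum-tabulate≡0 g eq Fin.zero    = m+n≡0⇒m≡0 _ eq
  sum-tabulate≡0 g eq (Fin.suc i) = sum-tabulate≡0 (g ∘ Fin.suc) (m+n≡0⇒n≡0 _ eq) i

  occ≡0⇒∉ : ∀ {x} E → occ x E ≡ 0 → x ∉ₑ E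
  occ≡0⇒∉ E eq =
    indicator≡0⇒≢ (m+n≡0⇒m≡0 _ eq) , indicator≡0⇒≢ ∘ sum-tabulate≡0 _ (m+n≡0⇒n≡0 _ eq)

  occs≡0⇒∉ : ∀ {x} ψs → occs x ψs ≡ 0 → All (x ∉ₑ_) ψs
  occs≡0⇒∉ []       _  = []
  occs≡0⇒∉ (E ∷ ψs) eq = occ≡0⇒∉ E (m+n≡0⇒m≡0 _ eq) ∷ occs≡0⇒∉ ψs (m+n≡0⇒n≡0 (occ _ E) eq)

  occs≡1⇒lhs-fresh : ∀ E ψs → occs (lhs E) (E ∷ ψs) ≡ 1 →
                     (∀ i → args E i ≢ lhs E) × All (lhs E ∉ₑ_) ψs
  occs≡1⇒lhs-fresh E ψs eq rewrite Equivalence.to T-≡ (≡⇒≡ᵇ (lhs E) (lhs E) refl) =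
    let rest≡0 = suc-injective eq
    in indicator≡0⇒≢ ∘ sum-tabulate≡0 _ (m+n≡0⇒m≡0 _ rest≡0) , occs≡0⇒∉ ψs (m+n≡0⇒n≡0 _ rest≡0)

  _[_≔_] : Assignment k → Var → Word k → Assignment k
  (ν [ x ≔ w ]) y with y ≟ x
  ... | yes _ = w
  ... | no _  = ν y

  ≔-same : ∀ ν x w → (ν [ x ≔ w ]) x ≡ w
  ≔-same ν x w with x ≟ x
  ... | yes _   = refl
  ... | no x≢x  = contradiction refl x≢x

  ≔-other : ∀ ν {x} w {y} → y ≢ x → (ν [ x ≔ w ]) y ≡ ν y
  ≔-other ν {x} w {y} y≢x with y ≟ x
  ... | yes y≡x = contradiction y≡x y≢x
  ... | no _    = refl

  ≔-defines : ∀ ν E → BackwardableEqn E → (∀ i → args E i ≢ lhs E) →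
              Holds (ν [ lhs E ≔ fun E (ν ∘ args E) ]) (eqn E)
  ≔-defines ν E bw args≢lhs =
    trans (≔-same ν (lhs E) _) (backwardable-ext bw (λ i → sym (≔-other ν _ (args≢lhs i))))

  ≔-preserves-eqn : ∀ ν {x} w E → BackwardableEqn E → x ∉ₑ E →
                    Holds ν (eqn E) → Holds (ν [ x ≔ w ]) (eqn E)
  ≔-preserves-eqn ν w E bw (lhs≢x , args≢x) h =
    trans (≔-other ν w lhs≢x) (trans h (backwardable-ext bw (λ i → sym (≔-other ν w (args≢x i)))))

  ≔-preserves-EqSat : ∀ ν {x} w ψs → All BackwardableEqn ψs →
                      All (x ∉ₑ_) ψs → EqSat ν ψs → EqSat (ν [ x ≔ w ]) ψs
  ≔-preserves-EqSat ν w []       []         []         []       = []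
  ≔-preserves-EqSat ν w (E ∷ ψs) (bw ∷ bws) (x∉ ∷ x∉s) (h ∷ hs) =
    ≔-preserves-eqn ν w E bw x∉ h ∷ ≔-preserves-EqSat ν w ψs bws x∉s hs

  ≔-RegSat : ∀ {ν x w S S′} → S ⊆ S′ → RegSat ν S′ → All (w ∈L_) (regsOf x S) →
             RegSat (ν [ x ≔ w ]) S
  ≔-RegSat {x = x} {S = S} S⊆S′ sat w∈ {y} y∈e∈S with y ≟ x
  ... | yes refl = All.lookup w∈ (regsOf-complete S y∈e∈S)
  ... | no _     = sat (S⊆S′ y∈e∈S)

  bwd-prop-all : ∀ {fwd S} E → eqn E ∈ S → BackwardableEqn E →
    (es : List (RegExp k)) → All (λ e → reg (lhs E) e ∈ S) es →
    (∀ {S′} → S ⊆ S′ → (∀ {ν} → RegSat ν S′ → All (fun E (ν ∘ args E) ∈L_) es) → RCP fwd S′) →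
    RCP fwd S
  bwd-prop-all E _ _ [] [] continue = continue id (λ _ → [])
  bwd-prop-all {S = S} E E∈S bw (e ∷ es) (e∈S ∷ es∈S) continue =
    let ds , preimage = bw e in
    bwd-prop E E∈S e (inj₁ e∈S) ds preimage λ d d∈ds →
      let arg-regs = tabulate (λ i → reg (args E i) (d i))
          S⊆ : S ⊆ reg (lhs E) e ∷ arg-regs ++ S
          S⊆ = there ∘ xs⊆ys++xs S arg-regs
      in bwd-prop-all E (S⊆ E∈S) bw es (All.map S⊆ es∈S) λ S″⊆S′ image →
        continue (S″⊆S′ ∘ S⊆) λ sat →
          Equivalence.from (preimage _)
            (lose d∈ds (λ i → sat (S″⊆S′ (there (xs⊆xs++ys arg-regs S (∈-tabulate⁺ i))))))
          ∷ image sat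

  refute-straight-line : ∀ {fwd S} ψs → StraightLineOrder ψs → All BackwardableEqn ψs →
    (∀ {E} → E ∈ ψs → eqn E ∈ S) → (∀ ν → RegSat ν S → ¬ EqSat ν ψs) → RCP fwd S
  refute-straight-line {S = S} [] _ _ _ unsat = refute-regular S (λ ν sat → unsat ν sat [])
  refute-straight-line {S = S} (E ∷ ψs) (once , order) (bw ∷ bws) ψs⊆S unsat =
    let args≢lhs , lhs∉ψs = occs≡1⇒lhs-fresh E ψs once in
    bwd-prop-all E (ψs⊆S (here refl)) bw (regsOf (lhs E) S) (regsOf-sound S) λ S⊆S′ image →
      refute-straight-line ψs order bws (S⊆S′ ∘ ψs⊆S ∘ there) λ ν sat eqs →
        let w = fun E (ν ∘ args E) in
        unsat (ν [ lhs E ≔ w ]) (≔-RegSat S⊆S′ sat (image sat))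
              (≔-defines ν E bw args≢lhs ∷ ≔-preserves-EqSat ν w ψs bws lhs∉ψs eqs)

  -- The φᵢ need not be distinct for this argument.
  straight-line-complete : ∀ {fwd} (S : Sequent k) → StraightLine S → Unsatisfiable S → RCP fwd S
  straight-line-complete S (backwardable , φs , _ , eqn∈S⇔ , order) unsat =
    refute-straight-line φs order (All.tabulate (backwardable _ ∘ from-φs)) from-φs
      λ ν sat eqs → unsat (ν , All.tabulate (holds sat eqs))
    where
    from-φs : ∀ {E} → E ∈ φs → eqn E ∈ S
    from-φs = Equivalence.from (eqn∈S⇔ _)

    holds : ∀ {ν} → RegSat ν S → EqSat ν φs → ∀ {c} → c ∈ S → Holds ν c
    holds sat _   {reg _ _} c∈S = sat c∈S
    holds _   eqs {eqn E}   c∈S = All.lookup eqs (Equivalence.to (eqn∈S⇔ E) c∈S)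

corollary2 : ∀ {k : ℕ} (S : Sequent k) → StraightLine S →
    (Unsatisfiable S ⇔ RCP true S) × (Unsatisfiable S → RCP false S)
corollary2 S straight =
  mk⇔ (straight-line-complete S straight) sound , straight-line-complete S straight
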